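{- For any simple binary Boolean VCSP instance $\mathcal{C}'$, there exists a simple trim binary Boolean VCSP instance $\mathcal{C}$ that is sign-equivalent to $\mathcal{C}'$ and satisfies $\mathrm{span}(\mathcal{C})\le\mathrm{span}(\mathcal{C}')$.
   Context: Variables are indexed by $[n]$, each with domain $\{0,1\}$; $x[i\mapsto b]$ is $x$ with coordinate $i$ set to $b$, $\bar b=1-b$. A (valued) constraint with scope $S\subseteq[n]$ is a function $C_S:\{0,1\}^S\to\mathbb{Z}$. A binary Boolean VCSP instance is a finite set of constraints with scopes of size at most $2$, at most one per scope; it implements $f(x)=\sum_{C_S\in\mathcal{C}}C_S(x[S])$. Its fitness graph $G_\mathcal{C}$ has vertex set $\{0,1\}^n$ and a directed edge $(x,y)$ iff $x,y$ differ in exactly one coordinate and $f(y)>f(x)$; two instances are sign-equivalent if they have the same fitness graph. The constraint graph has edge set $E(\mathcal{C})$ of those $\{i,j\}$ with a binary constraint of scope $\{i,j\}$ not identically zero. The span is $\mathrm{span}(\mathcal{C})=\sum_{C_S\in\mathcal{C}}(\max_z C_S(z)-\min_z C_S(z))$. An instance is simple if every unary constraint satisfies $C_i(0)=0,C_i(1)=c_i$ and every binary constraint satisfies $C_{ij}(0,0)=C_{ij}(0,1)=C_{ij}(1,0)=0$, $C_{ij}(1,1)=c_{ij}$ (a constant constraint is allowed). In $G_\mathcal{C}$, $i$ sign-depends on $j$ if there is $x$ with $(x,x[i\mapsto\bar x_i])\in E(G_\mathcal{C})$ but $(x[j\mapsto \bar x_j],x[i\mapsto\bar x_i,j\mapsto\bar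 x_j])\notin E(G_\mathcal{C})$; $i,j$ sign-interact if either sign-depends on the other. A simple instance is trim if for every $\{i,j\}\in E(\mathcal{C})$, $i$ and $j$ sign-interact in $G_\mathcal{C}$. -}

module Defs where

open import Data.Nat using (ℕ; zero; suc)
open import Data.Bool using (Bool; true; false; not; if_then_else_; _∧_)
open import Data.Fin using (Fin; zero; suc; _<_; _<?_; _≟_)
open import Data.Integer using (ℤ; 0ℤ; _+_; _-_; _<_; _⊔_; _⊓_)
open import Data.Product using (Σ; ∃; _×_; _,_)
open import Data.Sum using (_⊎_)
open import Relation.Nullary using (¬_; Dec; yes; no; does)
open import Relation.Binary.PropositionalEquality using (_≡_; _≢_)
open import Function.Bundles using (_⇔_)

Σ[_] : (n : ℕ) → (Fin n → ℤ) → ℤ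
Σ[ zero ] f = 0ℤ
Σ[ suc n ] f = f zero + Σ[ n ] (λ i → f (suc i))

-- An assignment x ∈ {0,1}^n (true = 1).
Assignment : ℕ → Set
Assignment n = Fin n → Bool

_[_↦_] : ∀ {n} → Assignment n → Fin n → Bool → Assignment n
(x [ i ↦ b ]) k = if does (k ≟ i) then b else x k

flip : ∀ {n} → Assignment n → Fin n → Assignment n
flip x i = x [ i ↦ not (x i) ]

-- A simple binary Boolean VCSP instance on n variables.
--   const          : the constant (scope ∅) constraint value
--   unary i        : c_i, i.e. C_i(0) = 0, C_i(1) = c_i
--   binary i j i<j : c_ij for the scope {i,j} (written with i < j, so at
--                    most one constraint per scope); C_ij(1,1) = c_ij, else 0.
-- A missing constraint is represented by the zero constraint (coefficient 0),
-- which changes neither f, nor the span, nor E(C).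
record SimpleInstance (n : ℕ) : Set where
  field
    const  : ℤ
    unary  : Fin n → ℤ
    binary : (i j : Fin n) → i Data.Fin.< j → ℤ
open SimpleInstance public

unaryVal : ℤ → Bool → ℤ
unaryVal c true  = c
unaryVal c false = 0ℤ

binaryVal : ℤ → Bool → Bool → ℤ
binaryVal c b b' = unaryVal c (b ∧ b')

pairTerm : ∀ {n} → SimpleInstance n → Assignment n → Fin n → Fin n → ℤ
pairTerm C x i j with i <? j
... | yes p = binaryVal (binary C i j p) (x i) (x j)
... | no _  = 0ℤ

eval : ∀ {n} → SimpleInstance n → Assignment n → ℤ
eval {n} C x = const C
             + Σ[ n ] (λ i → unaryVal (unary C i) (x i))
             + Σ[ n ] (λ i → Σ[ n ] (λ j → pairTerm C x i j))

Edge : ∀ {n} → SimpleInstance n → Assignment n → Assignment n → Set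
Edge {n} C x y = (∃ λ (i : Fin n) → ∀ k → y k ≡ flip x i k)
               × (eval C x Data.Integer.< eval C y)

SignEquivalent : ∀ {n} → SimpleInstance n → SimpleInstance n → Set
SignEquivalent {n} C C' = ∀ (x y : Assignment n) → Edge C x y ⇔ Edge C' x y

SignDepends : ∀ {n} → SimpleInstance n → Fin n → Fin n → Set
SignDepends {n} C i j =
  ∃ λ (x : Assignment n) →
    Edge C x (flip x i) × ¬ Edge C (flip x j) (flip (flip x j) i)

SignInteract : ∀ {n} → SimpleInstance n → Fin n → Fin n → Set
SignInteract C i j = SignDepends C i j ⊎ SignDepends C j i

Trim : ∀ {n} → SimpleInstance n → Set
Trim {n} C = ∀ (i j : Fin n) (p : i Data.Fin.< j) → binary C i j p ≢ 0ℤ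
           → SignInteract C i j

-- max_z C(z) − min_z C(z) for a constraint whose values are {0, c}
spanVal : ℤ → ℤ
spanVal c = (0ℤ ⊔ c) - (0ℤ ⊓ c)

pairSpan : ∀ {n} → SimpleInstance n → Fin n → Fin n → ℤ
pairSpan C i j with i <? j
... | yes p = spanVal (binary C i j p)
... | no _  = 0ℤ

-- span(C); the constant constraint has max − min = 0
span : ∀ {n} → SimpleInstance n → ℤ
span {n} C = Σ[ n ] (λ i → spanVal (unary C i))
           + Σ[ n ] (λ i → Σ[ n ] (λ j → pairSpan C i j))

-- Drop every binary constraint of C' whose endpoints do not sign-interact. For the trimmed
-- instance, the gain f(x with x_i flipped) − f(x) equals the gain of C' at the assignment obtained
-- from x by setting to 0 every x_k (k ≠ i) that does not sign-interact with i, because there every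
-- dropped constraint at {i, k} contributes nothing. As i does not sign-depend on these k, setting
-- them to 0 one at a time never changes whether flipping x_i improves C'; hence both instances
-- have the same fitness graph, therefore the same sign-interactions, and the trimmed one is trim.
module Submission where

open import Defs
open import Data.Nat using (ℕ; zero; suc)
open import Data.Bool using (true; false; not)
open import Data.Bool.Properties using (not-involutive)
open import Data.Fin using (Fin; zero; suc; _≟_; _<?_)
import Data.Fin.Properties as Fin
open import Data.Fin.Subset using (Subset)
open import Data.Fin.Subset.Properties using (anySubset?)
open import Data.Integer using (ℤ; 0ℤ; _+_; _-_; -_; _<_; _≤_; _⊔_; _⊓_)
import Data.Integer.Properties as ℤ
open import Data.Integer.Solver using (module +-*-Solver)
open import Data.List using (List; []; _∷_; filter; allFin)
open import Data.List.Membership.Propositional using (_∈_; _∉_)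
open import Data.List.Membership.Propositional.Properties
  using (∈-allFin; ∈-filter⁺; ∈-filter⁻)
open import Data.List.Relation.Unary.Any using (here; there)
open import Data.Product using (Σ; ∃; _×_; _,_; proj₁; proj₂)
open import Data.Sum using (inj₁; inj₂)
open import Data.Vec using (lookup; tabulate)
open import Data.Vec.Properties using (lookup∘tabulate)
open import Function using (_∘_)
open import Function.Bundles using (_⇔_; mk⇔; Equivalence)
import Function.Properties.Equivalence as ⇔
open import Relation.Nullary using (¬_; Dec; yes; no; contradiction)
open import Relation.Nullary.Decidable using (_×-dec_; _⊎-dec_; ¬?; map′; decidable-stable)
open import Relation.Binary.PropositionalEquality

open Equivalence using (to; from)

private
  variable
    n : ℕ

<-respects-difference : ∀ {a b c d : ℤ} → b - a ≡ d - c → a < b → c < d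
<-respects-difference {a} {b} {c} {d} eq a<b = begin-strict
  c            ≡⟨ sym (ℤ.+-identityʳ c) ⟩
  c + 0ℤ       ≡⟨ cong (c +_) (sym (ℤ.+-inverseʳ a)) ⟩
  c + (a - a)  <⟨ ℤ.+-monoʳ-< c (ℤ.+-monoˡ-< (- a) a<b) ⟩
  c + (b - a)  ≡⟨ cong (c +_) eq ⟩
  c + (d - c)  ≡⟨ solve 2 (λ c d → c :+ (d :- c) := d) refl c d ⟩
  d            ∎
  where
  open ℤ.≤-Reasoning
  open +-*-Solver

difference-self : ∀ (a b : ℤ) → a - a ≡ b - b
difference-self a b = trans (ℤ.+-inverseʳ a) (sym (ℤ.+-inverseʳ b))

0≤spanVal : ∀ c → 0ℤ ≤ spanVal c
0≤spanVal c = ℤ.i≤j⇒0≤j-i (ℤ.≤-trans (ℤ.i⊓j≤i 0ℤ c) (ℤ.i≤i⊔j 0ℤ c))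

Σ-cong : ∀ n {f g : Fin n → ℤ} → f ≗ g → Σ[ n ] f ≡ Σ[ n ] g
Σ-cong zero    f≗g = refl
Σ-cong (suc n) f≗g = cong₂ _+_ (f≗g zero) (Σ-cong n (f≗g ∘ suc))

Σ-mono-≤ : ∀ n {f g : Fin n → ℤ} → (∀ i → f i ≤ g i) → Σ[ n ] f ≤ Σ[ n ] g
Σ-mono-≤ zero    f≤g = ℤ.≤-refl
Σ-mono-≤ (suc n) f≤g = ℤ.+-mono-≤ (f≤g zero) (Σ-mono-≤ n (f≤g ∘ suc))

Σ-difference : ∀ n (f g : Fin n → ℤ) → Σ[ n ] f - Σ[ n ] g ≡ Σ[ n ] (λ i → f i - g i)
Σ-difference zero    f g = refl
Σ-difference (suc n) f g = begin
  (f zero + F) - (g zero + G)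
    ≡⟨ solve 4 (λ a b c d → (a :+ b) :- (c :+ d) := (a :- c) :+ (b :- d)) refl (f zero) F (g zero) G ⟩
  (f zero - g zero) + (F - G)
    ≡⟨ cong (f zero - g zero +_) (Σ-difference n (f ∘ suc) (g ∘ suc)) ⟩
  Σ[ suc n ] (λ i → f i - g i) ∎
  where
  open ≡-Reasoning
  open +-*-Solver
  F = Σ[ n ] (f ∘ suc)
  G = Σ[ n ] (g ∘ suc)

[↦]-same : ∀ (x : Assignment n) i b → (x [ i ↦ b ]) i ≡ b
[↦]-same x i b with i ≟ i
... | yes _   = refl
... | no i≢i = contradiction refl i≢i

[↦]-other : ∀ (x : Assignment n) {i k} b → k ≢ i → (x [ i ↦ b ]) k ≡ x k
[↦]-other x {i} {k} b k≢i with k ≟ i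
... | yes k≡i = contradiction k≡i k≢i
... | no _    = refl

flip-cong : ∀ {x y : Assignment n} → x ≗ y → ∀ i → flip x i ≗ flip y i
flip-cong x≗y i k with k ≟ i
... | yes _ = cong not (x≗y i)
... | no _  = x≗y k

flip-involutive : ∀ (x : Assignment n) i → flip (flip x i) i ≗ x
flip-involutive x i k with k ≟ i
... | no _     = refl
... | yes refl = trans (cong not ([↦]-same x k (not (x k)))) (not-involutive (x k))

binaryVal-zero : ∀ u v → binaryVal 0ℤ u v ≡ 0ℤ
binaryVal-zero true  true  = refl
binaryVal-zero true  false = refl
binaryVal-zero false v     = refl

binaryVal-falseʳ : ∀ c u → binaryVal c u false ≡ 0ℤ
binaryVal-falseʳ c true  = refl
binaryVal-falseʳ c false = refl

pairTerm-local : ∀ (C : SimpleInstance n) {x y : Assignment n} a b → x a ≡ y a → x b ≡ y b →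
  pairTerm C x a b ≡ pairTerm C y a b
pairTerm-local C a b xa≡ya xb≡yb with a <? b
... | yes p = cong₂ (binaryVal (binary C a b p)) xa≡ya xb≡yb
... | no _  = refl

pairTerm-≡ : ∀ (C : SimpleInstance n) x {a b} → a ≡ b → pairTerm C x a b ≡ 0ℤ
pairTerm-≡ C x {a} refl with a <? a
... | yes a<a = contradiction a<a (Fin.<-irrefl refl)
... | no _    = refl

pairTerm-falseˡ : ∀ (C : SimpleInstance n) {x} a b → x a ≡ false → pairTerm C x a b ≡ 0ℤ
pairTerm-falseˡ C {x} a b xa≡false with a <? b
... | yes p rewrite xa≡false = refl
... | no _  = refl

pairTerm-falseʳ : ∀ (C : SimpleInstance n) {x} a b → x b ≡ false → pairTerm C x a b ≡ 0ℤ
pairTerm-falseʳ C {x} a b xb≡false with a <? b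
... | yes p rewrite xb≡false = binaryVal-falseʳ (binary C a b p) (x a)
... | no _  = refl

eval-cong : ∀ (C : SimpleInstance n) {x y} → x ≗ y → eval C x ≡ eval C y
eval-cong {n} C x≗y =
  cong₂ _+_ (cong (const C +_) (Σ-cong n (λ i → cong (unaryVal (unary C i)) (x≗y i))))
            (Σ-cong n (λ a → Σ-cong n (λ b → pairTerm-local C a b (x≗y a) (x≗y b))))

unaryDiff : SimpleInstance n → Assignment n → Assignment n → Fin n → ℤ
unaryDiff C y z a = unaryVal (unary C a) (y a) - unaryVal (unary C a) (z a)

pairDiff : SimpleInstance n → Assignment n → Assignment n → Fin n → Fin n → ℤ
pairDiff C y z a b = pairTerm C y a b - pairTerm C z a b

eval-difference : ∀ (C : SimpleInstance n) y z →
  eval C y - eval C z ≡ Σ[ n ] (unaryDiff C y z) + Σ[ n ] (λ a → Σ[ n ] (pairDiff C y z a))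
eval-difference {n} C y z = begin
  (k + U y + P y) - (k + U z + P z)  ≡⟨ solve 5 (λ k u p u' p' → (k :+ u :+ p) :- (k :+ u' :+ p')
                                                                := (u :- u') :+ (p :- p'))
                                                refl k (U y) (P y) (U z) (P z) ⟩
  (U y - U z) + (P y - P z)          ≡⟨ cong₂ _+_ (Σ-difference n _ _) pairs ⟩
  Σ[ n ] (unaryDiff C y z) + Σ[ n ] (λ a → Σ[ n ] (pairDiff C y z a)) ∎
  where
  open ≡-Reasoning
  open +-*-Solver
  k = const C
  U P : Assignment n → ℤ
  U x = Σ[ n ] (λ i → unaryVal (unary C i) (x i))
  P x = Σ[ n ] (λ a → Σ[ n ] (λ b → pairTerm C x a b))
  pairs : P y - P z ≡ Σ[ n ] (λ a → Σ[ n ] (pairDiff C y z a))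
  pairs = trans (Σ-difference n _ _) (Σ-cong n (λ a → Σ-difference n _ _))

eval-difference-cong : ∀ (C C' : SimpleInstance n) {y z y' z'} →
  (∀ a → unaryDiff C y z a ≡ unaryDiff C' y' z' a) →
  (∀ a b → pairDiff C y z a b ≡ pairDiff C' y' z' a b) →
  eval C y - eval C z ≡ eval C' y' - eval C' z'
eval-difference-cong {n} C C' {y} {z} {y'} {z'} unary≡ pair≡ = begin
  eval C y - eval C z    ≡⟨ eval-difference C y z ⟩
  Σ[ n ] (unaryDiff C y z) + Σ[ n ] (λ a → Σ[ n ] (pairDiff C y z a))
    ≡⟨ cong₂ _+_ (Σ-cong n unary≡) (Σ-cong n (λ a → Σ-cong n (pair≡ a))) ⟩
  Σ[ n ] (unaryDiff C' y' z') + Σ[ n ] (λ a → Σ[ n ] (pairDiff C' y' z' a))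
    ≡⟨ sym (eval-difference C' y' z') ⟩
  eval C' y' - eval C' z' ∎
  where open ≡-Reasoning

unaryDiff-flip : ∀ (C : SimpleInstance n) {x x' : Assignment n} i → x i ≡ x' i →
  ∀ a → unaryDiff C (flip x i) x a ≡ unaryDiff C (flip x' i) x' a
unaryDiff-flip C {x} {x'} i xᵢ≡x'ᵢ a with a ≟ i
... | yes refl = cong (λ b → unaryVal (unary C a) (not b) - unaryVal (unary C a) b) xᵢ≡x'ᵢ
... | no _     = difference-self (unaryVal (unary C a) (x a)) (unaryVal (unary C a) (x' a))

flip-local : ∀ {x y : Assignment n} i k → x i ≡ y i → x k ≡ y k → flip x i k ≡ flip y i k
flip-local i k xi≡yi xk≡yk with k ≟ i
... | yes _ = cong not xi≡yi
... | no _  = xk≡yk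

pairDiff-flip-local : ∀ (C : SimpleInstance n) {x y : Assignment n} i a b →
  x i ≡ y i → x a ≡ y a → x b ≡ y b →
  pairDiff C (flip x i) x a b ≡ pairDiff C (flip y i) y a b
pairDiff-flip-local C i a b xi≡yi xa≡ya xb≡yb =
  cong₂ _-_ (pairTerm-local C a b (flip-local i a xi≡yi xa≡ya) (flip-local i b xi≡yi xb≡yb))
            (pairTerm-local C a b xa≡ya xb≡yb)

pairDiff-flip-other : ∀ (C : SimpleInstance n) x {i a b} → a ≢ i → b ≢ i →
  pairDiff C (flip x i) x a b ≡ 0ℤ
pairDiff-flip-other C x {i} {a} {b} a≢i b≢i =
  trans (cong (_- pairTerm C x a b)
              (pairTerm-local C a b ([↦]-other x _ a≢i) ([↦]-other x _ b≢i)))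
        (ℤ.+-inverseʳ (pairTerm C x a b))

pairDiff-flip-falseˡ : ∀ (C : SimpleInstance n) x {i a} b → a ≢ i → x a ≡ false →
  pairDiff C (flip x i) x a b ≡ 0ℤ
pairDiff-flip-falseˡ C x {a = a} b a≢i xa≡false =
  cong₂ _-_ (pairTerm-falseˡ C a b (trans ([↦]-other x _ a≢i) xa≡false))
            (pairTerm-falseˡ C a b xa≡false)

pairDiff-flip-falseʳ : ∀ (C : SimpleInstance n) x {i} a {b} → b ≢ i → x b ≡ false →
  pairDiff C (flip x i) x a b ≡ 0ℤ
pairDiff-flip-falseʳ C x a {b} b≢i xb≡false =
  cong₂ _-_ (pairTerm-falseʳ C a b (trans ([↦]-other x _ b≢i) xb≡false))
            (pairTerm-falseʳ C a b xb≡false)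

pairDiff-≡ : ∀ (C : SimpleInstance n) y z {a b} → a ≡ b → pairDiff C y z a b ≡ 0ℤ
pairDiff-≡ C y z a≡b = cong₂ _-_ (pairTerm-≡ C y a≡b) (pairTerm-≡ C z a≡b)

Improving : SimpleInstance n → Assignment n → Fin n → Set
Improving C x i = eval C x < eval C (flip x i)

improving? : ∀ (C : SimpleInstance n) x i → Dec (Improving C x i)
improving? C x i = eval C x ℤ.<? eval C (flip x i)

improving-cong : ∀ (C : SimpleInstance n) {x y} i → x ≗ y → Improving C x i → Improving C y i
improving-cong C i x≗y = subst₂ _<_ (eval-cong C x≗y) (eval-cong C (flip-cong x≗y i))

improving⇒edge : ∀ (C : SimpleInstance n) {x} i → Improving C x i → Edge C x (flip x i)
improving⇒edge C i x<x' = (i , λ _ → refl) , x<x'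

edge-transfer : ∀ (C C' : SimpleInstance n) → (∀ x i → Improving C x i → Improving C' x i) →
  ∀ {x y} → Edge C x y → Edge C' x y
edge-transfer C C' improving {x} ((i , y≗x') , x<y) = (i , y≗x') ,
  subst (eval C' x <_) (sym (eval-cong C' y≗x'))
        (improving x i (subst (eval C x <_) (eval-cong C y≗x') x<y))

signEquivalent : ∀ (C C' : SimpleInstance n) → (∀ x i → Improving C x i ⇔ Improving C' x i) →
  SignEquivalent C C'
signEquivalent C C' same _ _ = mk⇔ (edge-transfer C C' (λ x i → to (same x i)))
                                    (edge-transfer C' C (λ x i → from (same x i)))

signDepends⇔ : ∀ (C : SimpleInstance n) i k →
  SignDepends C i k ⇔ ∃ λ x → Improving C x i × ¬ Improving C (flip x k) i
signDepends⇔ C i k = mk⇔ (λ (x , e , ¬e) → x , proj₂ e , ¬e ∘ improving⇒edge C i)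
                         (λ (x , u , ¬u) → x , improving⇒edge C i u , ¬u ∘ proj₂)

-- Assignments are enumerated as subsets, i.e. as Boolean vectors.
signDepends? : ∀ (C : SimpleInstance n) i k → Dec (SignDepends C i k)
signDepends? {n} C i k = map′ (from (signDepends⇔ C i k) ∘ fromSubset) toSubset
  (anySubset? (λ v → witness? (lookup v)))
  where
  Witness : Assignment n → Set
  Witness x = Improving C x i × ¬ Improving C (flip x k) i
  witness? : ∀ x → Dec (Witness x)
  witness? x = improving? C x i ×-dec ¬? (improving? C (flip x k) i)
  witness-cong : ∀ {x y} → x ≗ y → Witness x → Witness y
  witness-cong x≗y (u , ¬u) =
    improving-cong C i x≗y u , ¬u ∘ improving-cong C i (flip-cong (sym ∘ x≗y) k)
  fromSubset : ∃ (λ (v : Subset n) → Witness (lookup v)) → ∃ Witness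
  fromSubset (v , w) = lookup v , w
  toSubset : SignDepends C i k → ∃ λ (v : Subset n) → Witness (lookup v)
  toSubset sd with to (signDepends⇔ C i k) sd
  ... | x , w = tabulate x , witness-cong (sym ∘ lookup∘tabulate x) w

signInteract? : ∀ (C : SimpleInstance n) i k → Dec (SignInteract C i k)
signInteract? C i k = signDepends? C i k ⊎-dec signDepends? C k i

signInteract-sym : ∀ (C : SimpleInstance n) {i k} → SignInteract C i k → SignInteract C k i
signInteract-sym C (inj₁ sd) = inj₂ sd
signInteract-sym C (inj₂ sd) = inj₁ sd

signDepends-transfer : ∀ (C C' : SimpleInstance n) → SignEquivalent C C' →
  ∀ {i j} → SignDepends C' i j → SignDepends C i j
signDepends-transfer C C' C≈C' {i} {j} (x , e , ¬e) =
  x , from (C≈C' x (flip x i)) e , ¬e ∘ to (C≈C' (flip x j) (flip (flip x j) i))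

signInteract-transfer : ∀ (C C' : SimpleInstance n) → SignEquivalent C C' →
  ∀ {i j} → SignInteract C' i j → SignInteract C i j
signInteract-transfer C C' C≈C' (inj₁ sd) = inj₁ (signDepends-transfer C C' C≈C' sd)
signInteract-transfer C C' C≈C' (inj₂ sd) = inj₂ (signDepends-transfer C C' C≈C' sd)

improving-flip : ∀ (C : SimpleInstance n) {i k} → ¬ SignDepends C i k →
  ∀ x → Improving C x i → Improving C (flip x k) i
improving-flip C {i} {k} ¬sd x u =
  decidable-stable (improving? C (flip x k) i)
                   (λ ¬u → ¬sd (from (signDepends⇔ C i k) (x , u , ¬u)))

improving-reset : ∀ (C : SimpleInstance n) {i k} → ¬ SignDepends C i k →
  ∀ x → Improving C x i ⇔ Improving C (x [ k ↦ false ]) i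
improving-reset C {i} {k} ¬sd x with x k in xₖ≡b
... | false = mk⇔ (improving-cong C i unchanged) (improving-cong C i (sym ∘ unchanged))
  where
  unchanged : x ≗ x [ k ↦ false ]
  unchanged l with l ≟ k
  ... | yes refl = xₖ≡b
  ... | no _     = refl
... | true = mk⇔ (improving-cong C i reset≗flip ∘ improving-flip C ¬sd x)
                 (improving-cong C i (flip-involutive x k) ∘ improving-flip C ¬sd (flip x k)
                   ∘ improving-cong C i (sym ∘ reset≗flip))
  where
  reset≗flip : flip x k ≗ x [ k ↦ false ]
  reset≗flip l with l ≟ k
  ... | yes _ = cong not xₖ≡b
  ... | no _  = refl

resetAll : List (Fin n) → Assignment n → Assignment n
resetAll []       x = x
resetAll (k ∷ ks) x = resetAll ks x [ k ↦ false ]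

resetAll-∈ : ∀ {ks : List (Fin n)} {k} x → k ∈ ks → resetAll ks x k ≡ false
resetAll-∈ {ks = k' ∷ ks} {k} x k∈ with k ≟ k' | k∈
... | yes _   | _          = refl
... | no k≢k' | here k≡k'  = contradiction k≡k' k≢k'
... | no _    | there k∈ks = resetAll-∈ x k∈ks

resetAll-∉ : ∀ {ks : List (Fin n)} {k} x → k ∉ ks → resetAll ks x k ≡ x k
resetAll-∉ {ks = []}      x k∉ = refl
resetAll-∉ {ks = k' ∷ ks} {k} x k∉ with k ≟ k'
... | yes k≡k' = contradiction (here k≡k') k∉
... | no _     = resetAll-∉ x (k∉ ∘ there)

resetAll-invariant : ∀ (P : Assignment n → Set) {ks} →
  (∀ {k} → k ∈ ks → ∀ y → P y ⇔ P (y [ k ↦ false ])) → ∀ x → P x ⇔ P (resetAll ks x)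
resetAll-invariant P {[]}     invariant x = ⇔.refl
resetAll-invariant P {k ∷ ks} invariant x =
  ⇔.trans (resetAll-invariant P (invariant ∘ there) x) (invariant (here refl) (resetAll ks x))

module Trimmed (C' : SimpleInstance n) where

  trimmedBinary : (a b : Fin n) → a Data.Fin.< b → ℤ
  trimmedBinary a b p with signInteract? C' a b
  ... | yes _ = binary C' a b p
  ... | no _  = 0ℤ

  trimmed : SimpleInstance n
  trimmed = record { const = const C' ; unary = unary C' ; binary = trimmedBinary }

  Reset : Fin n → Fin n → Set
  Reset i k = ¬ SignInteract C' i k × k ≢ i

  reset? : ∀ i k → Dec (Reset i k)
  reset? i k = ¬? (signInteract? C' i k) ×-dec ¬? (k ≟ i)

  mask : Fin n → Assignment n → Assignment n
  mask i = resetAll (filter (reset? i) (allFin n))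

  mask-keeps : ∀ i {k} x → ¬ Reset i k → mask i x k ≡ x k
  mask-keeps i x ¬reset = resetAll-∉ x (¬reset ∘ proj₂ ∘ ∈-filter⁻ (reset? i) {xs = allFin n})

  mask-resets : ∀ i {k} x → Reset i k → mask i x k ≡ false
  mask-resets i x reset = resetAll-∈ x (∈-filter⁺ (reset? i) (∈-allFin _) reset)

  mask-interacting : ∀ {i k x} → SignInteract C' i k → mask i x k ≡ x k
  mask-interacting {i} {x = x} interact = mask-keeps i x (λ (¬interact , _) → ¬interact interact)

  mask-at-self : ∀ {i k x} → k ≡ i → mask i x k ≡ x k
  mask-at-self {i} {x = x} k≡i = mask-keeps i x (λ (_ , k≢i) → k≢i k≡i)

  mask-self : ∀ i x → mask i x i ≡ x i
  mask-self i x = mask-at-self refl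

  improving-mask : ∀ x i → Improving C' x i ⇔ Improving C' (mask i x) i
  improving-mask x i = resetAll-invariant (λ y → Improving C' y i) reset-invariant x
    where
    reset-invariant : ∀ {k} → k ∈ filter (reset? i) (allFin n) →
      ∀ y → Improving C' y i ⇔ Improving C' (y [ k ↦ false ]) i
    reset-invariant k∈ =
      improving-reset C' (proj₁ (proj₂ (∈-filter⁻ (reset? i) {xs = allFin n} k∈)) ∘ inj₁)

  pairTerm-kept : ∀ x {a b} → SignInteract C' a b → pairTerm trimmed x a b ≡ pairTerm C' x a b
  pairTerm-kept x {a} {b} interact with a <? b
  ... | no _ = refl
  ... | yes p with signInteract? C' a b
  ...   | yes _        = refl
  ...   | no ¬interact = contradiction interact ¬interact

  pairTerm-dropped : ∀ x {a b} → ¬ SignInteract C' a b → pairTerm trimmed x a b ≡ 0ℤ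
  pairTerm-dropped x {a} {b} ¬interact with a <? b
  ... | no _ = refl
  ... | yes p with signInteract? C' a b
  ...   | yes interact = contradiction interact ¬interact
  ...   | no _         = binaryVal-zero (x a) (x b)

  -- A constraint at {i, j} is either kept, and then the mask does not touch x_j, or dropped,
  -- and then its C'-term vanishes because the mask has set x_j to 0.
  pairDiff-trimmed : ∀ x i a b →
    pairDiff trimmed (flip x i) x a b ≡ pairDiff C' (flip (mask i x) i) (mask i x) a b
  pairDiff-trimmed x i a b = by-cases (signInteract? C' a b) (a ≟ i) (b ≟ i)
    where
    m = mask i x
    Goal = pairDiff trimmed (flip x i) x a b ≡ pairDiff C' (flip m i) m a b

    kept : SignInteract C' a b → m a ≡ x a → m b ≡ x b → Goal
    kept interact ma≡xa mb≡xb =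
      trans (cong₂ _-_ (pairTerm-kept (flip x i) interact) (pairTerm-kept x interact))
            (pairDiff-flip-local C' i a b (sym (mask-self i x)) (sym ma≡xa) (sym mb≡xb))

    dropped : ¬ SignInteract C' a b → pairDiff C' (flip m i) m a b ≡ 0ℤ → Goal
    dropped ¬interact vanish =
      trans (cong₂ _-_ (pairTerm-dropped (flip x i) ¬interact) (pairTerm-dropped x ¬interact))
            (sym vanish)

    by-cases : Dec (SignInteract C' a b) → Dec (a ≡ i) → Dec (b ≡ i) → Goal
    by-cases _ (no a≢i) (no b≢i) =
      trans (pairDiff-flip-other trimmed x a≢i b≢i) (sym (pairDiff-flip-other C' m a≢i b≢i))
    by-cases _ (yes a≡i) (yes b≡i) =
      trans (pairDiff-≡ trimmed _ _ a≡b) (sym (pairDiff-≡ C' _ _ a≡b))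
      where a≡b = trans a≡i (sym b≡i)
    by-cases (yes interact) (yes a≡i) (no _) =
      kept interact (mask-at-self a≡i)
                    (mask-interacting (subst (λ k → SignInteract C' k b) a≡i interact))
    by-cases (yes interact) (no _) (yes b≡i) =
      kept interact
           (mask-interacting (signInteract-sym C' (subst (λ k → SignInteract C' a k) b≡i interact)))
           (mask-at-self b≡i)
    by-cases (no ¬interact) (yes a≡i) (no b≢i) =
      dropped ¬interact (pairDiff-flip-falseʳ C' m a b≢i
        (mask-resets i x ((¬interact ∘ subst (λ k → SignInteract C' k b) (sym a≡i)) , b≢i)))
    by-cases (no ¬interact) (no a≢i) (yes b≡i) =
      dropped ¬interact (pairDiff-flip-falseˡ C' m b a≢i (mask-resets i x (¬interacting , a≢i)))
      where
      ¬interacting : ¬ SignInteract C' i a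
      ¬interacting = ¬interact ∘ subst (λ k → SignInteract C' a k) (sym b≡i) ∘ signInteract-sym C'

  improving-trimmed : ∀ x i → Improving trimmed x i ⇔ Improving C' (mask i x) i
  improving-trimmed x i = mk⇔ (<-respects-difference difference≡)
                              (<-respects-difference (sym difference≡))
    where
    difference≡ : eval trimmed (flip x i) - eval trimmed x
                ≡ eval C' (flip (mask i x) i) - eval C' (mask i x)
    difference≡ = eval-difference-cong trimmed C' (unaryDiff-flip C' i (sym (mask-self i x)))
                                                   (pairDiff-trimmed x i)

  trimmed-signEquivalent : SignEquivalent trimmed C'
  trimmed-signEquivalent =
    signEquivalent trimmed C'
      (λ x i → ⇔.trans (improving-trimmed x i) (⇔.sym (improving-mask x i)))

  trimmed-trim : Trim trimmed
  trimmed-trim a b p c≢0 with signInteract? C' a b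
  ... | yes interact = signInteract-transfer trimmed C' trimmed-signEquivalent interact
  ... | no _         = contradiction refl c≢0

  pairSpan-trimmed : ∀ a b → pairSpan trimmed a b ≤ pairSpan C' a b
  pairSpan-trimmed a b with a <? b
  ... | no _ = ℤ.≤-refl
  ... | yes p with signInteract? C' a b
  ...   | yes _ = ℤ.≤-refl
  ...   | no _  = 0≤spanVal (binary C' a b p)

  trimmed-span : span trimmed ≤ span C'
  trimmed-span = ℤ.+-monoʳ-≤ (Σ[ n ] (spanVal ∘ unary C'))
                             (Σ-mono-≤ n (λ a → Σ-mono-≤ n (pairSpan-trimmed a)))

proposition7 : (n : ℕ) (C' : SimpleInstance n) →
    Σ (SimpleInstance n) (λ C → Trim C × SignEquivalent C C' × span C ≤ span C')
proposition7 n C' = trimmed , trimmed-trim , trimmed-signEquivalent , trimmed-span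
  where open Trimmed C'
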